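{- Let $G$ be a connected simple graph with $V(G)=\{1,\dots,n\}$. A sequence $(r_1,\dots,r_n)$ of integers is the score vector of some orientation of $G$ if and only if $\sum_{i=1}^n r_i=|E(G)|$ and $$2\sum_{i\in I}r_i\le|E(I)|+\sum_{i\in I}d_G(i)$$ for all sets $\emptyset\ne I\subsetneq\{1,\dots,n\}$ such that the induced subgraphs of $G$ on $I$ and on $\{1,\dots,n\}\setminus I$ are connected.
   Context: The score vector of a directed graph $D$ with $V(D)=\{1,\dots,n\}$ is $(d_D^+(1),\dots,d_D^+(n))$, the vector of outdegrees. An orientation of $G$ assigns a direction to each edge. $d_G(i)$ is the degree of $i$ in $G$, and $E(I)$ is the set of edges of $G$ with exactly one end in $I$. -}

module Defs where

open import Data.Nat using (ℕ; zero; suc; _+_; _<ᵇ_)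
open import Data.Integer as ℤ using (ℤ)
open import Data.Bool using (Bool; true; false; _∧_; _xor_; if_then_else_; not)
open import Data.Fin using (Fin; zero; suc; toℕ)
open import Data.Fin.Subset using (Subset; _∈_)
open import Data.Vec using (lookup)
open import Data.Product using (∃)
open import Relation.Binary.PropositionalEquality using (_≡_)

-- Simple graph on vertex set Fin n (vertices 1..n of the paper):
-- decidable symmetric irreflexive adjacency.
record Graph (n : ℕ) : Set where
  field
    adj   : Fin n → Fin n → Bool
    sym   : ∀ i j → adj i j ≡ adj j i
    irrefl : ∀ i → adj i i ≡ false
open Graph public

sumℕ : ∀ {n} → (Fin n → ℕ) → ℕ
sumℕ {zero}  f = 0
sumℕ {suc n} f = f zero + sumℕ (λ i → f (suc i))

sumℤ : ∀ {n} → (Fin n → ℤ) → ℤ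
sumℤ {zero}  f = ℤ.+ 0
sumℤ {suc n} f = f zero ℤ.+ sumℤ (λ i → f (suc i))

count : ∀ {n} → (Fin n → Bool) → ℕ
count p = sumℕ (λ i → if p i then 1 else 0)

deg : ∀ {n} → Graph n → Fin n → ℕ
deg G i = count (adj G i)

numEdges : ∀ {n} → Graph n → ℕ
numEdges G = sumℕ (λ i → count (λ j → adj G i j ∧ (toℕ i <ᵇ toℕ j)))

-- |E(I)| : number of edges with exactly one end in I
cutEdges : ∀ {n} → Graph n → Subset n → ℕ
cutEdges G I =
  sumℕ (λ i → count (λ j → adj G i j ∧ (toℕ i <ᵇ toℕ j) ∧ (lookup I i xor lookup I j)))

-- An orientation: dir i j = true means edge ij is directed i → j.
-- Every edge gets exactly one direction; non-edges get none.
record Orientation {n : ℕ} (G : Graph n) : Set where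
  field
    dir     : Fin n → Fin n → Bool
    dir-adj : ∀ i j → dir i j ≡ true → adj G i j ≡ true
    dir-one : ∀ i j → adj G i j ≡ true → dir i j ≡ not (dir j i)
open Orientation public

outdeg : ∀ {n} {G : Graph n} → Orientation G → Fin n → ℕ
outdeg o i = count (dir o i)

IsScoreVector : ∀ {n} → Graph n → (Fin n → ℤ) → Set
IsScoreVector G r = ∃ λ (o : Orientation G) → ∀ i → r i ≡ ℤ.+ (outdeg o i)

-- walks inside S (all vertices after the start lie in S)
data Reach {n} (G : Graph n) (S : Subset n) : Fin n → Fin n → Set where
  here : ∀ {x} → Reach G S x x
  step : ∀ {x y z} → adj G x y ≡ true → y ∈ S → Reach G S y z → Reach G S x z

InducedConnected : ∀ {n} → Graph n → Subset n → Set
InducedConnected G S = ∀ x y → x ∈ S → y ∈ S → Reach G S x y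

Connected : ∀ {n} → Graph n → Set
Connected G = ∀ x y → Reach G (Data.Fin.Subset.⊤) x y

sumOverℤ : ∀ {n} → Subset n → (Fin n → ℤ) → ℤ
sumOverℤ I r = sumℤ (λ i → if lookup I i then r i else ℤ.+ 0)

sumOverℕ : ∀ {n} → Subset n → (Fin n → ℕ) → ℕ
sumOverℕ I f = sumℕ (λ i → if lookup I i then f i else 0)

module Submission where

-- Necessity is double counting. For an orientation o and a vertex set L,
-- summing a local identity over all ordered pairs of vertices gives the
-- score identity
--   2 (Σ_{i∈L} d⁺(i) + #arcs entering L) = |E(L)| + Σ_{i∈L} d(i),
-- so the cut inequality always holds, with equality when no arc enters L;
-- the same count gives Σᵢ d⁺(i) = |E(G)|.
--
-- Sufficiency is an augmenting-path argument on the excess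
-- e(v) = d⁺(v) − r_v, whose total is 0. A "tight" set (connected, with
-- connected complement, entered by no arc) has Σ e ≥ 0 by the cut condition
-- and the equality case. If A is connected and no arc leaves A, then, G being
-- connected, each component of V∖A is tight and A absorbs it while staying
-- connected; hence Σ_{V∖A} e ≥ 0. Applied to the set reached from a vertex
-- with e > 0, this shows that some vertex with e < 0 is reachable, and
-- reversing a simple path between them lowers Σ|e| by two. Iterating from
-- any orientation ends in one with e = 0, whose score vector is r.

open import Defs hiding (sym)
open import Data.Nat using (ℕ; zero; suc; _+_; _*_; _≤_; _<_; z≤n; s≤s; _<ᵇ_)
open import Data.Nat.Properties
  using (≤-refl; n<1+n; +-comm; m<m+n; +-assoc; +-cancelʳ-≡; *-monoʳ-≤; ≤-pred; <-≤-trans; +-mono-≤; +-mono-<-≤; +-mono-≤-<; +-identityʳ; +-suc; m≤m+n; suc-injective)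
open import Data.Nat.Tactic.RingSolver using (solve-∀)
open import Data.Integer as ℤ using (ℤ; -[1+_]; 0ℤ; 1ℤ; ∣_∣)
import Data.Integer.Properties as ℤₚ
import Data.Integer.Tactic.RingSolver as ℤ-Solver
open import Data.Bool using (Bool; true; false; if_then_else_; _∧_; _∨_; _xor_; not)
import Data.Bool.Properties as Bool
open import Data.Fin using (Fin; zero; suc; toℕ)
open import Data.Fin.Properties using (toℕ-injective; any?; _≟_) renaming (suc-injective to Fin-suc-injective)
open import Data.Fin.Subset using (Subset; Nonempty; _∉_; ∁)
open import Data.Vec using (lookup; tabulate)
open import Data.Vec.Properties using ([]=⇒lookup; lookup⇒[]=; lookup∘tabulate; lookup-map)
open import Data.Product using (∃; _×_; _,_; proj₁; proj₂)
open import Data.Sum using (_⊎_; inj₁; inj₂)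
open import Data.Empty using (⊥; ⊥-elim)
open import Data.Unit using (⊤; tt)
open import Data.List using (List; []; _∷_)
open import Data.List.Relation.Unary.Any using (here; there)
open import Function using (_∘_)
open import Function.Bundles using (_⇔_; mk⇔)
open import Relation.Nullary using (¬_; Dec; yes; no; does)
open import Relation.Nullary.Decidable using (dec-true; dec-false; _×-dec_)
open import Relation.Binary.PropositionalEquality
open ≡-Reasoning

⟦_⟧ : Bool → ℕ
⟦ b ⟧ = if b then 1 else 0

sum-cong : ∀ {n} {f g : Fin n → ℕ} → (∀ i → f i ≡ g i) → sumℕ f ≡ sumℕ g
sum-cong {zero}  _ = refl
sum-cong {suc n} h = cong₂ _+_ (h zero) (sum-cong (λ i → h (suc i)))

sum-zero : ∀ n → sumℕ {n} (λ _ → 0) ≡ 0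
sum-zero zero    = refl
sum-zero (suc n) = sum-zero n

sum-+ : ∀ {n} (f g : Fin n → ℕ) → sumℕ (λ i → f i + g i) ≡ sumℕ f + sumℕ g
sum-+ {zero}  f g = refl
sum-+ {suc n} f g = begin
  f zero + g zero + sumℕ (λ i → f (suc i) + g (suc i))
    ≡⟨ cong (_+_ (f zero + g zero)) (sum-+ (λ i → f (suc i)) (λ i → g (suc i))) ⟩
  f zero + g zero + (sumℕ (λ i → f (suc i)) + sumℕ (λ i → g (suc i)))
    ≡⟨ interchange (f zero) (g zero) _ _ ⟩
  f zero + sumℕ (λ i → f (suc i)) + (g zero + sumℕ (λ i → g (suc i))) ∎
  where
  interchange : ∀ a b c d → a + b + (c + d) ≡ a + c + (b + d)
  interchange = solve-∀

sum-swap : ∀ {m n} (f : Fin m → Fin n → ℕ) →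
  sumℕ (λ i → sumℕ (λ j → f i j)) ≡ sumℕ (λ j → sumℕ (λ i → f i j))
sum-swap {zero}  {n} f = sym (sum-zero n)
sum-swap {suc m} {n} f = begin
  sumℕ (f zero) + sumℕ (λ i → sumℕ (λ j → f (suc i) j))
    ≡⟨ cong (_+_ (sumℕ (f zero))) (sum-swap (λ i j → f (suc i) j)) ⟩
  sumℕ (f zero) + sumℕ (λ j → sumℕ (λ i → f (suc i) j))
    ≡⟨ sum-+ (f zero) (λ j → sumℕ (λ i → f (suc i) j)) ⟨
  sumℕ (λ j → f zero j + sumℕ (λ i → f (suc i) j)) ∎

sum-mono : ∀ {n} {f g : Fin n → ℕ} → (∀ i → f i ≤ g i) → sumℕ f ≤ sumℕ g
sum-mono {zero}  _ = z≤n
sum-mono {suc n} h = +-mono-≤ (h zero) (sum-mono (λ i → h (suc i)))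

sum-strict : ∀ {n} {f g : Fin n → ℕ} → (∀ i → f i ≤ g i) → ∀ v → f v < g v → sumℕ f < sumℕ g
sum-strict {suc n} h zero    lt = +-mono-<-≤ lt (sum-mono (λ i → h (suc i)))
sum-strict {suc n} h (suc v) lt = +-mono-≤-< (h zero) (sum-strict (λ i → h (suc i)) v lt)

sum-update : ∀ {n} {f g : Fin n → ℕ} w → (∀ v → v ≢ w → f v ≡ g v) → sumℕ f + g w ≡ sumℕ g + f w
sum-update {suc n} {f} {g} zero agree = begin
  f zero + sumℕ (λ i → f (suc i)) + g zero ≡⟨ cong (λ s → f zero + s + g zero) rest ⟩
  f zero + sumℕ (λ i → g (suc i)) + g zero ≡⟨ swap-ends (f zero) _ (g zero) ⟩
  g zero + sumℕ (λ i → g (suc i)) + f zero ∎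
  where
  rest : sumℕ (λ i → f (suc i)) ≡ sumℕ (λ i → g (suc i))
  rest = sum-cong (λ i → agree (suc i) (λ ()))
  swap-ends : ∀ a b c → a + b + c ≡ c + b + a
  swap-ends = solve-∀
sum-update {suc n} {f} {g} (suc w) agree = begin
  f zero + sumℕ (λ i → f (suc i)) + g (suc w)   ≡⟨ +-assoc (f zero) _ _ ⟩
  f zero + (sumℕ (λ i → f (suc i)) + g (suc w)) ≡⟨ cong₂ _+_ (agree zero (λ ())) rest ⟩
  g zero + (sumℕ (λ i → g (suc i)) + f (suc w)) ≡⟨ +-assoc (g zero) _ _ ⟨
  g zero + sumℕ (λ i → g (suc i)) + f (suc w)   ∎
  where
  rest : sumℕ (λ i → f (suc i)) + g (suc w) ≡ sumℕ (λ i → g (suc i)) + f (suc w)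
  rest = sum-update w (λ v v≢w → agree (suc v) (λ e → v≢w (Fin-suc-injective e)))

DS : ∀ {n} → (Fin n → Fin n → ℕ) → ℕ
DS f = sumℕ (λ i → sumℕ (λ j → f i j))

DS-cong : ∀ {n} {f g : Fin n → Fin n → ℕ} → (∀ i j → f i j ≡ g i j) → DS f ≡ DS g
DS-cong h = sum-cong (λ i → sum-cong (h i))

DS-+ : ∀ {n} (f g : Fin n → Fin n → ℕ) → DS (λ i j → f i j + g i j) ≡ DS f + DS g
DS-+ f g = trans (sum-cong (λ i → sum-+ (f i) (g i))) (sum-+ (λ i → sumℕ (f i)) (λ i → sumℕ (g i)))

DS-symmetrize : ∀ {n} (f : Fin n → Fin n → ℕ) → DS (λ i j → f i j + f j i) ≡ DS f + DS f
DS-symmetrize f = trans (DS-+ f (λ i j → f j i)) (cong (_+_ (DS f)) (sum-swap (λ i j → f j i)))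

double-injective : ∀ {x y} → x + x ≡ y + y → x ≡ y
double-injective {zero}  {zero}  _ = refl
double-injective {suc x} {suc y} e =
  cong suc (double-injective (suc-injective (trans (sym (+-suc x x)) (trans (suc-injective e) (+-suc y y)))))

pairCount : ∀ {n} → (Fin n → Fin n → Bool) → ℕ
pairCount R = sumℕ (λ i → count (λ j → R i j ∧ (toℕ i <ᵇ toℕ j)))

one-smaller : ∀ m n → m ≢ n → ⟦ m <ᵇ n ⟧ + ⟦ n <ᵇ m ⟧ ≡ 1
one-smaller zero    zero    m≢n = ⊥-elim (m≢n refl)
one-smaller zero    (suc n) _   = refl
one-smaller (suc m) zero    _   = refl
one-smaller (suc m) (suc n) m≢n = one-smaller m n (λ m≡n → m≢n (cong suc m≡n))

irrefl-distinct : ∀ {n} (R : Fin n → Fin n → Bool) → (∀ i → R i i ≡ false) →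
  ∀ {i j} → R i j ≡ true → i ≢ j
irrefl-distinct R R-irrefl {i} Rii refl with () ← trans (sym Rii) (R-irrefl i)

pairCount-double : ∀ {n} (R : Fin n → Fin n → Bool) →
  (∀ i j → R i j ≡ R j i) → (∀ i → R i i ≡ false) →
  pairCount R + pairCount R ≡ DS (λ i j → ⟦ R i j ⟧)
pairCount-double {n} R R-sym R-irrefl = begin
  pairCount R + pairCount R              ≡⟨ DS-symmetrize ordered ⟨
  DS (λ i j → ordered i j + ordered j i) ≡⟨ DS-cong split ⟩
  DS (λ i j → ⟦ R i j ⟧)                  ∎
  where
  ordered : Fin n → Fin n → ℕ
  ordered i j = ⟦ R i j ∧ (toℕ i <ᵇ toℕ j) ⟧
  split : ∀ i j → ordered i j + ordered j i ≡ ⟦ R i j ⟧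
  split i j rewrite R-sym j i with R i j in Rij
  ... | false = refl
  ... | true  = one-smaller (toℕ i) (toℕ j) (λ i≡j → irrefl-distinct R R-irrefl Rij (toℕ-injective i≡j))

-- Vertex sets are handled through their characteristic predicates L; for a
-- subset I, sumOverℕ I f ≡ sumOver (lookup I) f and
-- cutEdges G I ≡ crossing G (lookup I) hold by definition.

sumOver : ∀ {n} → (Fin n → Bool) → (Fin n → ℕ) → ℕ
sumOver L f = sumℕ (λ i → if L i then f i else 0)

crossing : ∀ {n} → Graph n → (Fin n → Bool) → ℕ
crossing G L = sumℕ (λ i → count (λ j → adj G i j ∧ (toℕ i <ᵇ toℕ j) ∧ (L i xor L j)))

sumOver-count : ∀ {n} (L : Fin n → Bool) (p : Fin n → Fin n → Bool) →
  sumOver L (λ i → count (p i)) ≡ DS (λ i j → ⟦ L i ∧ p i j ⟧)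
sumOver-count {n} L p = sum-cong row
  where
  row : ∀ i → (if L i then count (p i) else 0) ≡ count (λ j → L i ∧ p i j)
  row i with L i
  ... | true  = refl
  ... | false = sym (sum-zero n)

crossing-double : ∀ {n} (G : Graph n) (L : Fin n → Bool) →
  crossing G L + crossing G L ≡ DS (λ i j → ⟦ adj G i j ∧ (L i xor L j) ⟧)
crossing-double {n} G L = begin
  crossing G L + crossing G L ≡⟨ cong₂ _+_ reorder reorder ⟩
  pairCount R + pairCount R   ≡⟨ pairCount-double R R-sym R-irrefl ⟩
  DS (λ i j → ⟦ R i j ⟧)      ∎
  where
  R : Fin n → Fin n → Bool
  R i j = adj G i j ∧ (L i xor L j)
  R-sym : ∀ i j → R i j ≡ R j i
  R-sym i j = cong₂ _∧_ (Graph.sym G i j) (Bool.xor-comm (L i) (L j))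
  R-irrefl : ∀ i → R i i ≡ false
  R-irrefl i = cong (_∧ (L i xor L i)) (irrefl G i)
  ∧-rotate : ∀ a b c → a ∧ b ∧ c ≡ (a ∧ c) ∧ b
  ∧-rotate false b c = refl
  ∧-rotate true  b c = Bool.∧-comm b c
  reorder : crossing G L ≡ pairCount R
  reorder = sum-cong (λ i → sum-cong (λ j → cong ⟦_⟧ (∧-rotate (adj G i j) _ _)))

data PairState : Bool → Bool → Bool → Set where
  edge    : ∀ d → PairState true d (not d)
  nonedge : PairState false false false

pairState : ∀ {n} {G : Graph n} (o : Orientation G) i j →
  PairState (adj G i j) (dir o i j) (dir o j i)
pairState {G = G} o i j with adj G i j in a
... | true  = subst (PairState true (dir o i j)) (sym (dir-one o j i (trans (Graph.sym G j i) a)))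
                (edge (dir o i j))
... | false = subst₂ (PairState false) (no-arc i j a) (no-arc j i (trans (Graph.sym G j i) a)) nonedge
  where
  no-arc : ∀ x y → adj G x y ≡ false → false ≡ dir o x y
  no-arc x y non with dir o x y in d
  ... | false = refl
  ... | true  with () ← trans (sym (dir-adj o x y d)) non

pair-arcs : ∀ {a d d'} → PairState a d d' → ⟦ d ⟧ + ⟦ d' ⟧ ≡ ⟦ a ⟧
pair-arcs (edge true)  = refl
pair-arcs (edge false) = refl
pair-arcs nonedge      = refl

arcWeight : Bool → Bool → Bool → ℕ
arcWeight Li Lj d = ⟦ Li ∧ d ⟧ + ⟦ not Li ∧ Lj ∧ d ⟧

-- The local form of the score identity: twice the weight of the arcs
-- between i and j equals the crossing indicator plus the degree
-- contributions of i and j to L.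
pair-score : ∀ {a d d'} → PairState a d d' → ∀ Li Lj →
  (arcWeight Li Lj d + arcWeight Lj Li d') + (arcWeight Li Lj d + arcWeight Lj Li d') ≡
  ⟦ a ∧ (Li xor Lj) ⟧ + (⟦ Li ∧ a ⟧ + ⟦ Lj ∧ a ⟧)
pair-score (edge true)  true  true  = refl
pair-score (edge true)  true  false = refl
pair-score (edge true)  false true  = refl
pair-score (edge true)  false false = refl
pair-score (edge false) true  true  = refl
pair-score (edge false) true  false = refl
pair-score (edge false) false true  = refl
pair-score (edge false) false false = refl
pair-score nonedge      true  true  = refl
pair-score nonedge      true  false = refl
pair-score nonedge      false true  = refl
pair-score nonedge      false false = refl

module _ {n} {G : Graph n} (o : Orientation G) where

  entering : (Fin n → Bool) → ℕ
  entering L = DS (λ i j → ⟦ not (L i) ∧ L j ∧ dir o i j ⟧)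

  outdeg-total : sumℕ (outdeg o) ≡ numEdges G
  outdeg-total = double-injective (begin
    sumℕ (outdeg o) + sumℕ (outdeg o)          ≡⟨ DS-symmetrize (λ i j → ⟦ dir o i j ⟧) ⟨
    DS (λ i j → ⟦ dir o i j ⟧ + ⟦ dir o j i ⟧) ≡⟨ DS-cong (λ i j → pair-arcs (pairState o i j)) ⟩
    DS (λ i j → ⟦ adj G i j ⟧)                 ≡⟨ pairCount-double (adj G) (Graph.sym G) (irrefl G) ⟨
    numEdges G + numEdges G                    ∎)

  arcWeight-total : ∀ L → DS (λ i j → arcWeight (L i) (L j) (dir o i j)) ≡ sumOver L (outdeg o) + entering L
  arcWeight-total L =
    trans (DS-+ (λ i j → ⟦ L i ∧ dir o i j ⟧) (λ i j → ⟦ not (L i) ∧ L j ∧ dir o i j ⟧))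
          (cong (_+ entering L) (sym (sumOver-count L (dir o))))

  score-identity : ∀ L → 2 * (sumOver L (outdeg o) + entering L) ≡ crossing G L + sumOver L (deg G)
  score-identity L = double-injective (begin
    2 * W + 2 * W                        ≡⟨ cong₂ _+_ quadruple quadruple ⟩
    DS s + DS s                          ≡⟨ DS-+ s s ⟨
    DS (λ i j → s i j + s i j)           ≡⟨ DS-cong (λ i j → pair-score (pairState o i j) (L i) (L j)) ⟩
    DS (λ i j → c i j + (d i j + d′ i j)) ≡⟨ DS-+ c (λ i j → d i j + d′ i j) ⟩
    DS c + DS (λ i j → d i j + d′ i j)    ≡⟨ cong₂ _+_ (sym (crossing-double G L)) (DS-+ d d′) ⟩
    C + C + (DS d + DS d′)               ≡⟨ cong (λ x → C + C + (DS d + x)) transpose ⟩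
    C + C + (DS d + DS d)                ≡⟨ cong (λ x → C + C + (x + x)) (sym (sumOver-count L (adj G))) ⟩
    C + C + (D + D)                      ≡⟨ interchange C D ⟩
    (C + D) + (C + D)                    ∎)
    where
    w s c d d′ : Fin n → Fin n → ℕ
    w i j = arcWeight (L i) (L j) (dir o i j)
    s i j = w i j + w j i
    c i j = ⟦ adj G i j ∧ (L i xor L j) ⟧
    d i j = ⟦ L i ∧ adj G i j ⟧
    d′ i j = ⟦ L j ∧ adj G i j ⟧
    C D W : ℕ
    C = crossing G L
    D = sumOver L (deg G)
    W = sumOver L (outdeg o) + entering L
    quadruple : 2 * W ≡ DS s
    quadruple = begin
      2 * W         ≡⟨ two-times W ⟩
      W + W         ≡⟨ cong₂ _+_ (arcWeight-total L) (arcWeight-total L) ⟨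
      DS w + DS w   ≡⟨ DS-symmetrize w ⟨
      DS s          ∎
      where
      two-times : ∀ x → 2 * x ≡ x + x
      two-times = solve-∀
    transpose : DS d′ ≡ DS d
    transpose = trans (sum-swap d′) (DS-cong (λ j i → cong (λ a → ⟦ L j ∧ a ⟧) (Graph.sym G i j)))
    interchange : ∀ a b → a + a + (b + b) ≡ (a + b) + (a + b)
    interchange = solve-∀

  score-bound : ∀ L → 2 * sumOver L (outdeg o) ≤ crossing G L + sumOver L (deg G)
  score-bound L = subst (2 * sumOver L (outdeg o) ≤_) (score-identity L)
                    (*-monoʳ-≤ 2 (m≤m+n (sumOver L (outdeg o)) (entering L)))

  ArcClosed : (Fin n → Bool) → Set
  ArcClosed L = ∀ u w → L u ≡ true → dir o u w ≡ true → L w ≡ true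

  score-tight : ∀ L → ArcClosed (λ v → not (L v)) →
    2 * sumOver L (outdeg o) ≡ crossing G L + sumOver L (deg G)
  score-tight L closed = begin
    2 * sumOver L (outdeg o)                ≡⟨ cong (2 *_) (+-identityʳ (sumOver L (outdeg o))) ⟨
    2 * (sumOver L (outdeg o) + 0)          ≡⟨ cong (λ x → 2 * (sumOver L (outdeg o) + x)) none-entering ⟨
    2 * (sumOver L (outdeg o) + entering L) ≡⟨ score-identity L ⟩
    crossing G L + sumOver L (deg G)        ∎
    where
    no-entering-arc : ∀ i j → ⟦ not (L i) ∧ L j ∧ dir o i j ⟧ ≡ 0
    no-entering-arc i j with L i in Li | L j in Lj | dir o i j in d
    ... | true  | _     | _     = refl
    ... | false | false | _     = refl
    ... | false | true  | false = refl
    ... | false | true  | true  with () ← trans (sym (cong not Lj)) (closed i j (cong not Li) d)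
    none-entering : entering L ≡ 0
    none-entering = begin
      entering L                           ≡⟨ DS-cong no-entering-arc ⟩
      sumℕ {n} (λ _ → sumℕ {n} (λ _ → 0))  ≡⟨ sum-cong {n} (λ _ → sum-zero n) ⟩
      sumℕ {n} (λ _ → 0)                   ≡⟨ sum-zero n ⟩
      0                                    ∎

sumℤ-cong : ∀ {n} {f g : Fin n → ℤ} → (∀ i → f i ≡ g i) → sumℤ f ≡ sumℤ g
sumℤ-cong {zero}  _ = refl
sumℤ-cong {suc n} h = cong₂ ℤ._+_ (h zero) (sumℤ-cong (λ i → h (suc i)))

sumℤ-pos : ∀ {n} (f : Fin n → ℕ) → sumℤ (λ i → ℤ.+ f i) ≡ ℤ.+ sumℕ f
sumℤ-pos {zero}  f = refl
sumℤ-pos {suc n} f = cong (ℤ._+_ (ℤ.+ f zero)) (sumℤ-pos (λ i → f (suc i)))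

sumℤ-+ : ∀ {n} (f g : Fin n → ℤ) → sumℤ (λ i → f i ℤ.+ g i) ≡ sumℤ f ℤ.+ sumℤ g
sumℤ-+ {zero}  f g = refl
sumℤ-+ {suc n} f g =
  trans (cong (ℤ._+_ (f zero ℤ.+ g zero)) (sumℤ-+ (λ i → f (suc i)) (λ i → g (suc i))))
        (interchange (f zero) (g zero) _ _)
  where
  interchange : ∀ a b c d → a ℤ.+ b ℤ.+ (c ℤ.+ d) ≡ a ℤ.+ c ℤ.+ (b ℤ.+ d)
  interchange = ℤ-Solver.solve-∀

sumℤ-- : ∀ {n} (f g : Fin n → ℤ) → sumℤ (λ i → f i ℤ.- g i) ≡ sumℤ f ℤ.- sumℤ g
sumℤ-- {zero}  f g = refl
sumℤ-- {suc n} f g =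
  trans (cong (ℤ._+_ (f zero ℤ.- g zero)) (sumℤ-- (λ i → f (suc i)) (λ i → g (suc i))))
        (interchange (f zero) (g zero) _ _)
  where
  interchange : ∀ a b c d → a ℤ.- b ℤ.+ (c ℤ.- d) ≡ a ℤ.+ c ℤ.- (b ℤ.+ d)
  interchange = ℤ-Solver.solve-∀

sumℤ-nonneg : ∀ {n} (f : Fin n → ℤ) → (∀ i → 0ℤ ℤ.≤ f i) → 0ℤ ℤ.≤ sumℤ f
sumℤ-nonneg {zero}  f _ = ℤₚ.≤-refl
sumℤ-nonneg {suc n} f h = ℤₚ.+-mono-≤ (h zero) (sumℤ-nonneg (λ i → f (suc i)) (λ i → h (suc i)))

sumℤ-nonneg-≥ : ∀ {n} (f : Fin n → ℤ) → (∀ i → 0ℤ ℤ.≤ f i) → ∀ v → f v ℤ.≤ sumℤ f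
sumℤ-nonneg-≥ {suc n} f h zero    =
  ℤₚ.i≤i+j (f zero) (sumℤ (λ i → f (suc i))) ⦃ ℤ.nonNegative (sumℤ-nonneg (λ i → f (suc i)) (λ i → h (suc i))) ⦄
sumℤ-nonneg-≥ {suc n} f h (suc v) =
  ℤₚ.≤-trans (sumℤ-nonneg-≥ (λ i → f (suc i)) (λ i → h (suc i)) v)
             (ℤₚ.i≤j+i (sumℤ (λ i → f (suc i))) (f zero) ⦃ ℤ.nonNegative (h zero) ⦄)

sumℤ-nonpos-≤ : ∀ {n} (f : Fin n → ℤ) → (∀ i → f i ℤ.≤ 0ℤ) → ∀ v → sumℤ f ℤ.≤ f v
sumℤ-nonpos-≤ f h v = ℤₚ.neg-cancel-≤ (ℤₚ.≤-trans
  (sumℤ-nonneg-≥ (λ i → ℤ.- f i) (λ i → ℤₚ.neg-mono-≤ (h i)) v)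
  (ℤₚ.≤-reflexive (sumℤ-neg f)))
  where
  sumℤ-neg : ∀ {n} (f : Fin n → ℤ) → sumℤ (λ i → ℤ.- f i) ≡ ℤ.- sumℤ f
  sumℤ-neg {zero}  f = refl
  sumℤ-neg {suc n} f = trans (cong (ℤ._+_ (ℤ.- f zero)) (sumℤ-neg (λ i → f (suc i))))
                              (sym (ℤₚ.neg-distrib-+ (f zero) _))

sumOverZ : ∀ {n} → (Fin n → Bool) → (Fin n → ℤ) → ℤ
sumOverZ L f = sumℤ (λ v → if L v then f v else 0ℤ)

sumOverZ-split : ∀ {n} (B C : Fin n → Bool) (f : Fin n → ℤ) → (∀ v → C v ≡ true → B v ≡ true) →
  sumOverZ B f ≡ sumOverZ C f ℤ.+ sumOverZ (λ v → B v ∧ not (C v)) f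
sumOverZ-split B C f C⊆B =
  trans (sumℤ-cong split) (sumℤ-+ (λ v → if C v then f v else 0ℤ) (λ v → if B v ∧ not (C v) then f v else 0ℤ))
  where
  split : ∀ v → (if B v then f v else 0ℤ) ≡
    (if C v then f v else 0ℤ) ℤ.+ (if B v ∧ not (C v) then f v else 0ℤ)
  split v with C v in Cv
  ... | true  rewrite C⊆B v Cv = sym (ℤₚ.+-identityʳ (f v))
  ... | false with B v
  ...   | true  = sym (ℤₚ.+-identityˡ (f v))
  ...   | false = refl

true≢false : true ≢ false
true≢false ()

_≟ᵇ_ : ∀ {n} → Fin n → Fin n → Bool
v ≟ᵇ w = does (v ≟ w)

≟ᵇ-sound : ∀ {n} {v w : Fin n} → v ≟ᵇ w ≡ true → v ≡ w
≟ᵇ-sound {v = v} {w} e with v ≟ w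
... | yes v≡w = v≡w

data Walk {n} (E : Fin n → Fin n → Bool) (S : Fin n → Bool) : Fin n → Fin n → Set where
  stop : ∀ {x} → Walk E S x x
  move : ∀ {x y z} → E x y ≡ true → S y ≡ true → Walk E S y z → Walk E S x z

module _ {n} {E : Fin n → Fin n → Bool} {S : Fin n → Bool} where

  _++ʷ_ : ∀ {x y z} → Walk E S x y → Walk E S y z → Walk E S x z
  stop         ++ʷ q = q
  move e s p   ++ʷ q = move e s (p ++ʷ q)

  reverseʷ : (∀ a b → E a b ≡ E b a) → ∀ {x y} → S x ≡ true → Walk E S x y → Walk E S y x
  reverseʷ E-sym Sx stop = stop
  reverseʷ E-sym Sx (move {x} {y} e Sy p) = reverseʷ E-sym Sy p ++ʷ move (trans (E-sym y x) e) Sx stop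

  record Exit (L : Fin n → Bool) (x : Fin n) : Set where
    field
      last      : Fin n
      first     : Fin n
      inside    : Walk E L x last
      last∈L    : L last ≡ true
      exit-step : E last first ≡ true
      first∉L   : L first ≡ false

  exit : ∀ (L : Fin n → Bool) {x t} → Walk E S x t → L x ≡ true → L t ≡ false → Exit L x
  exit L stop Lx Lt with () ← trans (sym Lx) Lt
  exit L (move {x} {y} e Sy p) Lx Lt with L y in Ly
  ... | true  = let open Exit (exit L p Ly Lt) in
                record { inside = move e Ly inside ; last∈L = last∈L ; exit-step = exit-step ; first∉L = first∉L }
  ... | false = record { inside = stop ; last∈L = Lx ; exit-step = e ; first∉L = Ly }

weaken : ∀ {n} {E E′ : Fin n → Fin n → Bool} {S S′ : Fin n → Bool} →
  (∀ a b → E a b ≡ true → E′ a b ≡ true) → (∀ v → S v ≡ true → S′ v ≡ true) →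
  ∀ {x y} → Walk E S x y → Walk E′ S′ x y
weaken E⊆E′ S⊆S′ stop         = stop
weaken E⊆E′ S⊆S′ (move e s p) = move (E⊆E′ _ _ e) (S⊆S′ _ s) (weaken E⊆E′ S⊆S′ p)

module _ {n} (E : Fin n → Fin n → Bool) (D : Fin n → Bool) (x : Fin n) where

  record Reached (C : Fin n → Bool) : Set where
    field
      origin : C x ≡ true
      within : ∀ v → C v ≡ true → D v ≡ true
      walk   : ∀ v → C v ≡ true → Walk E C x v

  record Closure : Set where
    field
      set     : Fin n → Bool
      reached : Reached set
      closed  : ∀ u w → set u ≡ true → E u w ≡ true → D w ≡ true → set w ≡ true
    open Reached reached public

  private
    remaining : (Fin n → Bool) → ℕ
    remaining C = count (λ v → D v ∧ not (C v))

    add : (Fin n → Bool) → Fin n → Fin n → Bool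
    add C w v = C v ∨ (v ≟ᵇ w)

    add-reached : ∀ {C u w} → Reached C → C u ≡ true → E u w ≡ true → D w ≡ true → Reached (add C w)
    add-reached {C} {u} {w} R Cu Euw Dw = record { origin = grow x origin ; within = within′ ; walk = walk′ }
      where
      open Reached R
      grow : ∀ v → C v ≡ true → add C w v ≡ true
      grow v Cv rewrite Cv = refl
      within′ : ∀ v → add C w v ≡ true → D v ≡ true
      within′ v e with C v in Cv
      ... | true  = within v Cv
      ... | false = subst (λ a → D a ≡ true) (sym (≟ᵇ-sound e)) Dw
      walk′ : ∀ v → add C w v ≡ true → Walk E (add C w) x v
      walk′ v e with C v in Cv
      ... | true  = weaken (λ _ _ z → z) grow (walk v Cv)
      ... | false = subst (Walk E (add C w) x) (sym (≟ᵇ-sound e))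
                      (weaken (λ _ _ z → z) grow (walk u Cu) ++ʷ move Euw (grow-w w) stop)
        where
        grow-w : ∀ a → add C a a ≡ true
        grow-w a rewrite dec-true (a ≟ a) refl = Bool.∨-zeroʳ (C a)

    add-remaining : ∀ C w → D w ≡ true → C w ≡ false → remaining (add C w) < remaining C
    add-remaining C w Dw Cw = sum-strict pointwise w at-w
      where
      pointwise : ∀ v → ⟦ D v ∧ not (add C w v) ⟧ ≤ ⟦ D v ∧ not (C v) ⟧
      pointwise v with D v | C v | v ≟ᵇ w
      ... | false | _     | _     = z≤n
      ... | true  | true  | _     = z≤n
      ... | true  | false | true  = z≤n
      ... | true  | false | false = ≤-refl
      at-w : ⟦ D w ∧ not (add C w w) ⟧ < ⟦ D w ∧ not (C w) ⟧
      at-w rewrite Dw | Cw | dec-true (w ≟ w) refl = s≤s z≤n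

    frontier-step : ∀ a b c d → a ∧ b ∧ c ∧ not d ≡ true →
      a ≡ true × b ≡ true × c ≡ true × d ≡ false
    frontier-step true true true false _ = refl , refl , refl , refl

    saturate : ∀ k C → remaining C < k → Reached C → Closure
    saturate (suc k) C bound R
      with any? (λ u → any? (λ w → C u ∧ E u w ∧ D w ∧ not (C w) Bool.≟ true))
    ... | no none = record { set = C ; reached = R ; closed = closed }
      where
      closed : ∀ u w → C u ≡ true → E u w ≡ true → D w ≡ true → C w ≡ true
      closed u w Cu Euw Dw with C w in Cw
      ... | true  = refl
      ... | false = ⊥-elim (none (u , w , frontier))
        where
        frontier : C u ∧ E u w ∧ D w ∧ not (C w) ≡ true
        frontier rewrite Cu | Euw | Dw | Cw = refl
    ... | yes (u , w , e) with frontier-step (C u) (E u w) (D w) (C w) e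
    ...   | Cu , Euw , Dw , Cw = saturate k (add C w) (<-≤-trans (add-remaining C w Dw Cw) (≤-pred bound))
                                   (add-reached R Cu Euw Dw)

  abstract
    closure : D x ≡ true → Closure
    closure Dx = saturate (suc (remaining single)) single (n<1+n _) record
      { origin = dec-true (x ≟ x) refl
      ; within = λ v e → subst (λ a → D a ≡ true) (sym (≟ᵇ-sound e)) Dx
      ; walk   = λ v e → subst (Walk E single x) (sym (≟ᵇ-sound e)) stop
      }
      where
      single : Fin n → Bool
      single v = v ≟ᵇ x

module _ {n} (G : Graph n) where

  reach→walk : ∀ {S x y} → Reach G S x y → Walk (adj G) (λ _ → true) x y
  reach→walk here           = stop
  reach→walk (step e _ p)   = move e refl (reach→walk p)

  walk→reach : ∀ (I : Subset n) {x y} → Walk (adj G) (lookup I) x y → Reach G I x y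
  walk→reach I stop                   = here
  walk→reach I (move {y = y} e Iy p)  = step e (lookup⇒[]= y I Iy) (walk→reach I p)

  rooted-connected : ∀ (I : Subset n) root → lookup I root ≡ true →
    (∀ v → lookup I v ≡ true → Walk (adj G) (lookup I) root v) → InducedConnected G I
  rooted-connected I root I-root walks x y x∈I y∈I = walk→reach I
    (reverseʷ (Graph.sym G) I-root (walks x ([]=⇒lookup x∈I)) ++ʷ walks y ([]=⇒lookup y∈I))

δ : ∀ {n} → Fin n → Fin n → ℕ
δ v w = ⟦ v ≟ᵇ w ⟧

δ-self : ∀ {n} (v : Fin n) → δ v v ≡ 1
δ-self v = cong ⟦_⟧ (dec-true (v ≟ v) refl)

δ-other : ∀ {n} {v w : Fin n} → v ≢ w → δ v w ≡ 0
δ-other {v = v} {w} v≢w = cong ⟦_⟧ (dec-false (v ≟ w) v≢w)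

sum-δ : ∀ {n} (w : Fin n) → sumℕ (λ v → δ v w) ≡ 1
sum-δ {n} w = begin
  sumℕ (λ v → δ v w)              ≡⟨ +-identityʳ _ ⟨
  sumℕ (λ v → δ v w) + 0          ≡⟨ sum-update w (λ v v≢w → δ-other v≢w) ⟩
  sumℕ {n} (λ _ → 0) + δ w w      ≡⟨ cong₂ _+_ (sum-zero n) (δ-self w) ⟩
  1                               ∎

module _ {n} {G : Graph n} where

  ScoreShift : Orientation G → Orientation G → Fin n → Fin n → Set
  ScoreShift o′ o i j = ∀ v → outdeg o′ v + δ v i ≡ outdeg o v + δ v j

  shift-trans : ∀ {o₀ o₁ o₂ x y z} → ScoreShift o₁ o₀ x y → ScoreShift o₂ o₁ y z → ScoreShift o₂ o₀ x z
  shift-trans {o₀} {o₁} {o₂} {x} {y} {z} s₁ s₂ v = +-cancelʳ-≡ (δ v y) _ _ (begin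
    outdeg o₂ v + δ v x + δ v y  ≡⟨ exchange (outdeg o₂ v) (δ v x) (δ v y) ⟩
    outdeg o₂ v + δ v y + δ v x  ≡⟨ cong (_+ δ v x) (s₂ v) ⟩
    outdeg o₁ v + δ v z + δ v x  ≡⟨ exchange (outdeg o₁ v) (δ v z) (δ v x) ⟩
    outdeg o₁ v + δ v x + δ v z  ≡⟨ cong (_+ δ v z) (s₁ v) ⟩
    outdeg o₀ v + δ v y + δ v z  ≡⟨ exchange (outdeg o₀ v) (δ v y) (δ v z) ⟩
    outdeg o₀ v + δ v z + δ v y  ∎)
    where
    exchange : ∀ a b c → a + b + c ≡ a + c + b
    exchange = solve-∀

  module ReverseArc (o : Orientation G) (x y : Fin n) (x→y : dir o x y ≡ true) where

    onArc : Fin n → Fin n → Bool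
    onArc a b = (a ≟ᵇ x ∧ b ≟ᵇ y) ∨ (a ≟ᵇ y ∧ b ≟ᵇ x)

    x≢y : x ≢ y
    x≢y = irrefl-distinct (adj G) (irrefl G) (dir-adj o x y x→y)

    onArc-sym : ∀ a b → onArc a b ≡ onArc b a
    onArc-sym a b = begin
      (a ≟ᵇ x ∧ b ≟ᵇ y) ∨ (a ≟ᵇ y ∧ b ≟ᵇ x) ≡⟨ Bool.∨-comm (a ≟ᵇ x ∧ b ≟ᵇ y) _ ⟩
      (a ≟ᵇ y ∧ b ≟ᵇ x) ∨ (a ≟ᵇ x ∧ b ≟ᵇ y) ≡⟨ cong₂ _∨_ (Bool.∧-comm (a ≟ᵇ y) _) (Bool.∧-comm (a ≟ᵇ x) _) ⟩
      (b ≟ᵇ x ∧ a ≟ᵇ y) ∨ (b ≟ᵇ y ∧ a ≟ᵇ x) ∎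

    onArc-adj : ∀ a b → onArc a b ≡ true → adj G a b ≡ true
    onArc-adj a b e with a ≟ x | b ≟ y | a ≟ y | b ≟ x
    ... | yes refl | yes refl | _        | _        = dir-adj o x y x→y
    ... | _        | _        | yes refl | yes refl = trans (Graph.sym G y x) (dir-adj o x y x→y)
    ... | no _     | _        | no _     | _        with () ← e
    ... | yes _    | no _     | no _     | _        with () ← e
    ... | no _     | _        | yes _    | no _     with () ← e
    ... | yes _    | no _     | yes _    | no _     with () ← e

    reversed : Orientation G
    reversed = record { dir = dir′ ; dir-adj = dir-adj′ ; dir-one = dir-one′ }
      where
      dir′ : Fin n → Fin n → Bool
      dir′ a b = dir o a b xor onArc a b
      dir-adj′ : ∀ a b → dir′ a b ≡ true → adj G a b ≡ true
      dir-adj′ a b e with onArc a b in on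
      ... | true  = onArc-adj a b on
      ... | false = dir-adj o a b (trans (sym (Bool.xor-identityʳ (dir o a b))) e)
      dir-one′ : ∀ a b → adj G a b ≡ true → dir′ a b ≡ not (dir′ b a)
      dir-one′ a b ab = begin
        dir o a b xor onArc a b        ≡⟨ cong₂ _xor_ (dir-one o a b ab) (onArc-sym a b) ⟩
        not (dir o b a) xor onArc b a  ≡⟨ Bool.not-distribˡ-xor (dir o b a) _ ⟨
        not (dir o b a xor onArc b a)  ∎

    onArc-off : ∀ a b → ¬ (a ≡ x × b ≡ y) → ¬ (a ≡ y × b ≡ x) → onArc a b ≡ false
    onArc-off a b not-xy not-yx with a ≟ x | b ≟ y | a ≟ y | b ≟ x
    ... | yes p | yes q | _     | _     = ⊥-elim (not-xy (p , q))
    ... | _     | _     | yes p | yes q = ⊥-elim (not-yx (p , q))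
    ... | no _  | _     | no _  | _     = refl
    ... | yes _ | no _  | no _  | _     = refl
    ... | no _  | _     | yes _ | no _  = refl
    ... | yes _ | no _  | yes _ | no _  = refl

    kept : ∀ a b → ¬ (a ≡ x × b ≡ y) → ¬ (a ≡ y × b ≡ x) → dir reversed a b ≡ dir o a b
    kept a b not-xy not-yx =
      trans (cong (dir o a b xor_) (onArc-off a b not-xy not-yx)) (Bool.xor-identityʳ (dir o a b))

    unchanged : ∀ a b → a ≢ x → b ≢ x → dir reversed a b ≡ dir o a b
    unchanged a b a≢x b≢x = kept a b (λ (a≡x , _) → a≢x a≡x) (λ (_ , b≡x) → b≢x b≡x)

    y↛x : dir o y x ≡ false
    y↛x = trans (dir-one o y x (trans (Graph.sym G y x) (dir-adj o x y x→y))) (cong not x→y)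

    flipped-xy : dir reversed x y ≡ false
    flipped-xy rewrite x→y | dec-true (x ≟ x) refl | dec-true (y ≟ y) refl = refl

    flipped-yx : dir reversed y x ≡ true
    flipped-yx rewrite y↛x | dec-true (x ≟ x) refl | dec-true (y ≟ y) refl = Bool.∨-zeroʳ _

    shift : ScoreShift reversed o x y
    shift v = by-cases (v ≟ x) (v ≟ y)
      where
      P : Fin n → Set
      P u = outdeg reversed u + δ u x ≡ outdeg o u + δ u y
      at-x : P x
      at-x = begin
        outdeg reversed x + δ x x          ≡⟨ cong₂ _+_ refl (trans (δ-self x) (cong ⟦_⟧ (sym x→y))) ⟩
        outdeg reversed x + ⟦ dir o x y ⟧  ≡⟨ sum-update y (λ b b≢y → cong ⟦_⟧ (kept x b
                                                (λ (_ , b≡y) → b≢y b≡y) (λ (x≡y , _) → x≢y x≡y))) ⟩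
        outdeg o x + ⟦ dir reversed x y ⟧  ≡⟨ cong₂ _+_ refl (trans (cong ⟦_⟧ flipped-xy) (sym (δ-other x≢y))) ⟩
        outdeg o x + δ x y                 ∎
      at-y : P y
      at-y = begin
        outdeg reversed y + δ y x          ≡⟨ cong₂ _+_ refl (trans (δ-other (x≢y ∘ sym)) (cong ⟦_⟧ (sym y↛x))) ⟩
        outdeg reversed y + ⟦ dir o y x ⟧  ≡⟨ sum-update x (λ b b≢x → cong ⟦_⟧ (kept y b
                                                (λ (y≡x , _) → x≢y (sym y≡x)) (λ (_ , b≡x) → b≢x b≡x))) ⟩
        outdeg o y + ⟦ dir reversed y x ⟧  ≡⟨ cong₂ _+_ refl (trans (cong ⟦_⟧ flipped-yx) (sym (δ-self y))) ⟩
        outdeg o y + δ y y                 ∎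
      elsewhere : v ≢ x → v ≢ y → P v
      elsewhere v≢x v≢y = cong₂ _+_
        (sum-cong (λ b → cong ⟦_⟧ (kept v b (λ (v≡x , _) → v≢x v≡x) (λ (v≡y , _) → v≢y v≡y))))
        (trans (δ-other v≢x) (sym (δ-other v≢y)))
      by-cases : Dec (v ≡ x) → Dec (v ≡ y) → P v
      by-cases (yes v≡x) _         = subst P (sym v≡x) at-x
      by-cases (no v≢x)  (yes v≡y) = subst P (sym v≡y) at-y
      by-cases (no v≢x)  (no v≢y)  = elsewhere v≢x v≢y

  open import Data.List.Membership.Propositional using () renaming (_∈_ to _∈ₗ_; _∉_ to _∉ₗ_)

  Path : Orientation G → Fin n → List (Fin n) → Fin n → Set
  Path o x []       z = x ≡ z
  Path o x (y ∷ ys) z = dir o x y ≡ true × Path o y ys z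

  Simple : Fin n → List (Fin n) → Set
  Simple x []       = ⊤
  Simple x (y ∷ ys) = x ∉ₗ y ∷ ys × Simple y ys

  walk→path : ∀ {o : Orientation G} {S x z} → Walk (dir o) S x z → ∃ λ ys → Path o x ys z
  walk→path stop = [] , refl
  walk→path (move {y = y} e _ p) = let (ys , path) = walk→path p in y ∷ ys , e , path

  module _ {o : Orientation G} where
    open import Data.List.Membership.DecPropositional (_≟_ {n}) using (_∈?_)

    suffix : ∀ {x y z} ys → Path o y ys z → Simple y ys → x ∈ₗ y ∷ ys → ∃ λ zs → Path o x zs z × Simple x zs
    suffix ys       path        simple       (here refl) = ys , path , simple
    suffix (w ∷ ys) (_ , path) (_ , simple) (there x∈)  = suffix ys path simple x∈

    loop-erase : ∀ {x z} ys → Path o x ys z → ∃ λ zs → Path o x zs z × Simple x zs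
    loop-erase []       path = [] , path , tt
    loop-erase {x} (y ∷ ys) (x→y , path) with loop-erase ys path
    ... | zs , path′ , simple with x ∈? y ∷ zs
    ...   | yes x∈ = suffix zs path′ simple x∈
    ...   | no x∉  = y ∷ zs , (x→y , path′) , (x∉ , simple)

  reverse-path : ∀ ys (o : Orientation G) x z → Path o x ys z → Simple x ys →
    ∃ λ o′ → ScoreShift o′ o x z
  reverse-path []       o x .x refl     _              = o , λ v → refl
  reverse-path (y ∷ ys) o x z  (x→y , path) (x∉ , simple) =
    let (o′ , shift′) = reverse-path ys reversed y z (keep-path ys path (x∉ ∘ here ∘ sym) (x∉ ∘ there)) simple
    in o′ , shift-trans {o₀ = o} {o₁ = reversed} {o₂ = o′} {x} {y} {z} shift shift′
    where
    open ReverseArc o x y x→y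
    -- The rest of the path avoids x, so reversing x → y does not touch it.
    keep-path : ∀ {a} bs → Path o a bs z → a ≢ x → x ∉ₗ bs → Path reversed a bs z
    keep-path []       path       _   _  = path
    keep-path {a} (b ∷ bs) (a→b , path) a≢x x∉bs =
      trans (unchanged a b a≢x b≢x) a→b , keep-path bs path b≢x (x∉bs ∘ there)
      where
      b≢x : b ≢ x
      b≢x b≡x = x∉bs (here (sym b≡x))

abs-step-pos : ∀ t u → u ≡ t ℤ.+ 1ℤ → 0ℤ ℤ.< u → ∣ t ∣ + 1 ≡ ∣ u ∣
abs-step-pos (ℤ.+ m)          _ refl _              = refl
abs-step-pos -[1+ zero ]      _ refl (ℤ.+<+ ())
abs-step-pos -[1+ suc m ]     _ refl ()

abs-step-neg : ∀ t u → t ≡ u ℤ.+ 1ℤ → u ℤ.< 0ℤ → ∣ t ∣ + 1 ≡ ∣ u ∣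
abs-step-neg _ -[1+ zero ]    refl _ = refl
abs-step-neg _ -[1+ suc m ]   refl _ = cong suc (+-comm m 1)
abs-step-neg _ (ℤ.+ m)        refl (ℤ.+<+ ())

pos-step : ∀ a b s → a + 1 ≡ b + 0 → ℤ.+ b ℤ.- s ≡ (ℤ.+ a ℤ.- s) ℤ.+ 1ℤ
pos-step a b s a+1≡b = begin
  ℤ.+ b ℤ.- s                ≡⟨ cong (λ x → ℤ.+ x ℤ.- s) (trans (sym (+-identityʳ b)) (sym a+1≡b)) ⟩
  ℤ.+ (a + 1) ℤ.- s          ≡⟨ cong (ℤ._- s) (ℤₚ.pos-+ a 1) ⟩
  ℤ.+ a ℤ.+ 1ℤ ℤ.- s         ≡⟨ reassociate (ℤ.+ a) s ⟩
  (ℤ.+ a ℤ.- s) ℤ.+ 1ℤ       ∎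
  where
  reassociate : ∀ x y → x ℤ.+ 1ℤ ℤ.- y ≡ (x ℤ.- y) ℤ.+ 1ℤ
  reassociate = ℤ-Solver.solve-∀

CutCondition : ∀ {n} → Graph n → (Fin n → ℤ) → Set
CutCondition {n} G r = ∀ (I : Subset n) → Nonempty I → (∃ λ x → x ∉ I) →
  InducedConnected G I → InducedConnected G (∁ I) →
  ℤ.+ 2 ℤ.* sumOverℤ I r ℤ.≤ ℤ.+ (cutEdges G I + sumOverℕ I (deg G))

module Sufficiency {n} (G : Graph n) (connected : Connected G) (r : Fin n → ℤ)
                   (total : sumℤ r ≡ ℤ.+ numEdges G) (cut-condition : CutCondition G r) where

  excess : Orientation G → Fin n → ℤ
  excess o v = ℤ.+ outdeg o v ℤ.- r v

  excess-total : ∀ o → sumℤ (excess o) ≡ 0ℤ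
  excess-total o = begin
    sumℤ (excess o)                      ≡⟨ sumℤ-- (λ v → ℤ.+ outdeg o v) r ⟩
    sumℤ (λ v → ℤ.+ outdeg o v) ℤ.- sumℤ r ≡⟨ cong₂ ℤ._-_ (trans (sumℤ-pos (outdeg o)) (cong ℤ.+_ (outdeg-total o))) total ⟩
    ℤ.+ numEdges G ℤ.- ℤ.+ numEdges G     ≡⟨ ℤₚ.+-inverseʳ (ℤ.+ numEdges G) ⟩
    0ℤ                                   ∎

  excess-over : ∀ o L → sumOverZ L (excess o) ≡ ℤ.+ sumOver L (outdeg o) ℤ.- sumOverZ L r
  excess-over o L = begin
    sumOverZ L (excess o)                       ≡⟨ sumℤ-cong restrict ⟩
    sumℤ (λ v → ℤ.+ out v ℤ.- (if L v then r v else 0ℤ))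
      ≡⟨ sumℤ-- (λ v → ℤ.+ out v) (λ v → if L v then r v else 0ℤ) ⟩
    sumℤ (λ v → ℤ.+ out v) ℤ.- sumOverZ L r     ≡⟨ cong (ℤ._- sumOverZ L r) (sumℤ-pos out) ⟩
    ℤ.+ sumOver L (outdeg o) ℤ.- sumOverZ L r   ∎
    where
    out : Fin n → ℕ
    out v = if L v then outdeg o v else 0
    restrict : ∀ v → (if L v then excess o v else 0ℤ) ≡ ℤ.+ out v ℤ.- (if L v then r v else 0ℤ)
    restrict v with L v
    ... | true  = refl
    ... | false = refl

  -- A tight set: connected, with connected complement, and entered by no arc.
  -- The cut condition and the equality case of the score identity give it
  -- nonnegative total excess.
  tight-set : ∀ o (C : Fin n → Bool) b x₀ → C b ≡ true → C x₀ ≡ false →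
    (∀ v → C v ≡ true → Walk (adj G) C b v) →
    (∀ v → C v ≡ false → Walk (adj G) (not ∘ C) x₀ v) →
    ArcClosed o (not ∘ C) → 0ℤ ℤ.≤ sumOverZ C (excess o)
  tight-set o C b x₀ Cb Cx₀ C-walks C̅-walks C̅-closed = subst (0ℤ ℤ.≤_) (sumℤ-cong on-C)
    (subst (0ℤ ℤ.≤_) (sym (excess-over o L)) (ℤₚ.i≤j⇒0≤j-i r≤out))
    where
    I : Subset n
    I = tabulate C
    L : Fin n → Bool
    L = lookup I
    L≡C : ∀ v → L v ≡ C v
    L≡C = lookup∘tabulate C
    ∁L≡C̅ : ∀ v → lookup (∁ I) v ≡ not (C v)
    ∁L≡C̅ v = trans (lookup-map v not I) (cong not (L≡C v))
    on-C : ∀ v → (if L v then excess o v else 0ℤ) ≡ (if C v then excess o v else 0ℤ)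
    on-C v = cong (λ c → if c then excess o v else 0ℤ) (L≡C v)
    I-connected : InducedConnected G I
    I-connected = rooted-connected G I b (trans (L≡C b) Cb)
      λ v Lv → weaken (λ _ _ e → e) (λ u Cu → trans (L≡C u) Cu) (C-walks v (trans (sym (L≡C v)) Lv))
    ∁I-connected : InducedConnected G (∁ I)
    ∁I-connected = rooted-connected G (∁ I) x₀ (trans (∁L≡C̅ x₀) (cong not Cx₀))
      λ v ∁Lv → weaken (λ _ _ e → e) (λ u C̅u → trans (∁L≡C̅ u) C̅u)
        (C̅-walks v (Bool.not-injective (trans (sym (∁L≡C̅ v)) ∁Lv)))
    tight : 2 * sumOver L (outdeg o) ≡ cutEdges G I + sumOverℕ I (deg G)
    tight = score-tight o L λ u w L̅u u→w →
      trans (cong not (L≡C w)) (C̅-closed u w (trans (cong not (sym (L≡C u))) L̅u) u→w)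
    r≤out : sumOverZ L r ℤ.≤ ℤ.+ sumOver L (outdeg o)
    r≤out = ℤₚ.*-cancelˡ-≤-pos (sumOverZ L r) (ℤ.+ sumOver L (outdeg o)) (ℤ.+ 2)
      (subst (ℤ.+ 2 ℤ.* sumOverZ L r ℤ.≤_) (trans (cong ℤ.+_ (sym tight)) (ℤₚ.pos-* 2 (sumOver L (outdeg o))))
        (cut-condition I (b , lookup⇒[]= b I (trans (L≡C b) Cb))
                         (x₀ , λ x₀∈I → true≢false (trans (trans (sym ([]=⇒lookup x₀∈I)) (L≡C x₀)) Cx₀))
                         I-connected ∁I-connected))

  record Absorbing (o : Orientation G) (i : Fin n) (A : Fin n → Bool) : Set where
    field
      root   : A i ≡ true
      walks  : ∀ v → A v ≡ true → Walk (adj G) A i v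
      closed : ArcClosed o A

  -- The component C of a vertex b outside an absorbing set A, within the
  -- complement of A. It is a tight set, and A ∪ C is again absorbing.
  module Component {o i A} (absorbing : Absorbing o i A) (b : Fin n) (A̅b : A b ≡ false) where
    open Absorbing absorbing

    component : Closure (adj G) (not ∘ A) b
    component = closure (adj G) (not ∘ A) b (cong not A̅b)

    open Closure component renaming (set to C; closed to C-closed; walk to C-walk)

    C⇒A̅ : ∀ v → C v ≡ true → A v ≡ false
    C⇒A̅ v Cv = Bool.not-injective (within v Cv)

    boundary : ∀ u w → C u ≡ true → adj G u w ≡ true → C w ≡ false → A w ≡ true
    boundary u w Cu uw C̅w with A w in Aw
    ... | true  = refl
    ... | false with () ← trans (sym (C-closed u w Cu uw (cong not Aw))) C̅w

    A⇒C̅ : ∀ u → A u ≡ true → not (C u) ≡ true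
    A⇒C̅ u Au with C u in Cu
    ... | false = refl
    ... | true  with () ← trans (sym Au) (C⇒A̅ u Cu)

    -- Every vertex outside C is reached from i avoiding C: follow a walk
    -- to i until it first meets A, then go back to i inside A.
    outside-walks : ∀ v → C v ≡ false → Walk (adj G) (not ∘ C) i v
    outside-walks v C̅v with A v in Av
    ... | true  = weaken (λ _ _ e → e) A⇒C̅ (walks v Av)
    ... | false = weaken (λ _ _ e → e) A⇒C̅ (walks w Aw)
                    ++ʷ move (trans (Graph.sym G w u) exit-step) (proj₂ (S-parts u last∈L))
                          (weaken (λ _ _ e → e) (λ t St → proj₂ (S-parts t St)) (reverseʷ (Graph.sym G) Sv inside))
      where
      S : Fin n → Bool
      S u = not (A u) ∧ not (C u)
      Sv : S v ≡ true
      Sv rewrite Av | C̅v = refl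
      S-parts : ∀ u → S u ≡ true → A u ≡ false × not (C u) ≡ true
      S-parts u Su with A u | C u
      ... | false | false = refl , refl
      open Exit (exit S (reach→walk G (connected v i)) Sv (cong (λ a → not a ∧ not (C i)) root))
        renaming (last to u; first to w)
      -- w is not in C: otherwise u, a neighbour of w outside A, would be in C.
      C̅w : A w ≡ false → ⊥
      C̅w A̅w = true≢false (trans (sym (C-closed w u Cw (trans (Graph.sym G w u) exit-step)
                                                       (cong not (proj₁ (S-parts u last∈L)))))
                                 (Bool.not-injective (proj₂ (S-parts u last∈L))))
        where
        Cw : C w ≡ true
        Cw = Bool.not-injective (subst (λ a → not a ∧ not (C w) ≡ false) A̅w first∉L)
      Aw : A w ≡ true
      Aw with A w in A?w
      ... | true  = refl
      ... | false = ⊥-elim (C̅w A?w)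

    head-adj : ∀ {u w} → dir o u w ≡ true → adj G w u ≡ true
    head-adj {u} {w} u→w = trans (Graph.sym G w u) (dir-adj o u w u→w)

    -- No arc enters C: arcs from A stay in A, and an arc from the rest of
    -- the complement into C would make its tail part of C.
    C̅-closed : ArcClosed o (not ∘ C)
    C̅-closed u w C̅u u→w with C w in Cw | A u in Au
    ... | false | _     = refl
    ... | true  | true  with () ← trans (sym (closed u w Au u→w)) (C⇒A̅ w Cw)
    ... | true  | false with () ← trans (sym (cong not (C-closed w u Cw (head-adj u→w) (cong not Au)))) C̅u

    A∪C : Fin n → Bool
    A∪C v = A v ∨ C v

    A⇒A∪C : ∀ v → A v ≡ true → A∪C v ≡ true
    A⇒A∪C v Av rewrite Av = refl

    C⇒A∪C : ∀ v → C v ≡ true → A∪C v ≡ true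
    C⇒A∪C v Cv rewrite Cv = Bool.∨-zeroʳ (A v)

    absorbed : Absorbing o i A∪C
    absorbed = record { root = A⇒A∪C i root ; walks = walks′ ; closed = closed′ }
      where
      -- A walk from b to i leaves C at some u into w ∈ A.
      open Exit (exit C (reach→walk G (connected b i)) origin (Bool.not-injective (A⇒C̅ i root)))
        renaming (last to u; first to w)
      walks′ : ∀ v → A∪C v ≡ true → Walk (adj G) A∪C i v
      walks′ v A∪Cv with A v in Av
      ... | true  = weaken (λ _ _ e → e) A⇒A∪C (walks v Av)
      ... | false = weaken (λ _ _ e → e) A⇒A∪C (walks w (boundary u w last∈L exit-step first∉L))
                      ++ʷ move (trans (Graph.sym G w u) exit-step) (C⇒A∪C u last∈L)
                            (weaken (λ _ _ e → e) C⇒A∪C (reverseʷ (Graph.sym G) origin inside ++ʷ C-walk v A∪Cv))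
      closed′ : ArcClosed o A∪C
      closed′ u w A∪Cu u→w with A w in Aw
      ... | true  = refl
      ... | false with A u in Au
      ...   | true  with () ← trans (sym (closed u w Au u→w)) Aw
      ...   | false = C-closed u w A∪Cu (dir-adj o u w u→w) (cong not Aw)

    shrinks : count (λ v → not (A∪C v)) < count (λ v → not (A v))
    shrinks = sum-strict pointwise b at-b
      where
      pointwise : ∀ v → ⟦ not (A∪C v) ⟧ ≤ ⟦ not (A v) ⟧
      pointwise v with A v | C v
      ... | true  | _     = z≤n
      ... | false | true  = z≤n
      ... | false | false = ≤-refl
      at-b : ⟦ not (A∪C b) ⟧ < ⟦ not (A b) ⟧
      at-b = subst₂ (λ a c → ⟦ not (a ∨ c) ⟧ < ⟦ not a ⟧) (sym A̅b) (sym origin) (s≤s z≤n)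

    split : ∀ f → sumOverZ (not ∘ A) f ≡ sumOverZ C f ℤ.+ sumOverZ (λ v → not (A∪C v)) f
    split f = trans (sumOverZ-split (not ∘ A) C f within)
                    (cong (ℤ._+_ (sumOverZ C f)) (sumℤ-cong de-morgan))
      where
      de-morgan : ∀ v → (if not (A v) ∧ not (C v) then f v else 0ℤ) ≡ (if not (A∪C v) then f v else 0ℤ)
      de-morgan v with A v
      ... | true  = refl
      ... | false = refl

  -- The complement of an absorbing set has nonnegative total excess: it is
  -- exhausted by components, each a tight set.
  absorbing-complement : ∀ k o i A → count (λ v → not (A v)) < k → Absorbing o i A →
    0ℤ ℤ.≤ sumOverZ (not ∘ A) (excess o)
  absorbing-complement (suc k) o i A bound absorbing with any? (λ v → A v Bool.≟ false)
  ... | no all-in = sumℤ-nonneg _ nothing-outside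
    where
    nothing-outside : ∀ v → 0ℤ ℤ.≤ (if not (A v) then excess o v else 0ℤ)
    nothing-outside v with A v in Av
    ... | true  = ℤₚ.≤-refl
    ... | false = ⊥-elim (all-in (v , Av))
  ... | yes (b , A̅b) = subst (0ℤ ℤ.≤_) (sym (split (excess o)))
    (ℤₚ.+-mono-≤ (tight-set o C b i origin (Bool.not-injective (A⇒C̅ i root)) C-walk outside-walks C̅-closed)
                 (absorbing-complement k o i A∪C (<-≤-trans shrinks (≤-pred bound)) absorbed))
    where
    open Absorbing absorbing using (root)
    open Component absorbing b A̅b
    open Closure component using (origin) renaming (set to C; walk to C-walk)

  -- Σᵥ |excess o v|, which vanishes exactly when o realizes r.
  potential : Orientation G → ℕ
  potential o = sumℕ (λ v → ∣ excess o v ∣)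

  excess-shift : ∀ {o′ o i j} → ScoreShift o′ o i j →
    0ℤ ℤ.< excess o i → excess o j ℤ.< 0ℤ →
    ∀ v → ∣ excess o′ v ∣ + δ v i + δ v j ≡ ∣ excess o v ∣
  excess-shift {o′} {o} {i} {j} shift surplus deficit v = by-cases (v ≟ i) (v ≟ j)
    where
    i≢j : i ≢ j
    i≢j refl = ℤₚ.<-asym surplus deficit
    P : Fin n → Set
    P v = ∣ excess o′ v ∣ + δ v i + δ v j ≡ ∣ excess o v ∣
    at-i : P i
    at-i = begin
      ∣ excess o′ i ∣ + δ i i + δ i j ≡⟨ cong₂ (λ a c → ∣ excess o′ i ∣ + a + c) (δ-self i) (δ-other i≢j) ⟩
      ∣ excess o′ i ∣ + 1 + 0         ≡⟨ +-identityʳ _ ⟩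
      ∣ excess o′ i ∣ + 1             ≡⟨ abs-step-pos (excess o′ i) (excess o i) unit-step surplus ⟩
      ∣ excess o i ∣                  ∎
      where
      unit-step : excess o i ≡ excess o′ i ℤ.+ 1ℤ
      unit-step = pos-step (outdeg o′ i) (outdeg o i) (r i)
        (subst₂ (λ a c → outdeg o′ i + a ≡ outdeg o i + c) (δ-self i) (δ-other i≢j) (shift i))
    at-j : P j
    at-j = begin
      ∣ excess o′ j ∣ + δ j i + δ j j ≡⟨ cong₂ (λ a c → ∣ excess o′ j ∣ + a + c) (δ-other (i≢j ∘ sym)) (δ-self j) ⟩
      ∣ excess o′ j ∣ + 0 + 1         ≡⟨ cong (_+ 1) (+-identityʳ _) ⟩
      ∣ excess o′ j ∣ + 1             ≡⟨ abs-step-neg (excess o′ j) (excess o j) unit-step deficit ⟩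
      ∣ excess o j ∣                  ∎
      where
      unit-step : excess o′ j ≡ excess o j ℤ.+ 1ℤ
      unit-step = pos-step (outdeg o j) (outdeg o′ j) (r j)
        (sym (subst₂ (λ a c → outdeg o′ j + a ≡ outdeg o j + c) (δ-other (i≢j ∘ sym)) (δ-self j) (shift j)))
    elsewhere : v ≢ i → v ≢ j → P v
    elsewhere v≢i v≢j = begin
      ∣ excess o′ v ∣ + δ v i + δ v j ≡⟨ cong₂ (λ a c → ∣ excess o′ v ∣ + a + c) (δ-other v≢i) (δ-other v≢j) ⟩
      ∣ excess o′ v ∣ + 0 + 0         ≡⟨ trans (+-identityʳ _) (+-identityʳ _) ⟩
      ∣ excess o′ v ∣                 ≡⟨ cong (λ x → ∣ ℤ.+ x ℤ.- r v ∣) same ⟩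
      ∣ excess o v ∣                  ∎
      where
      same : outdeg o′ v ≡ outdeg o v
      same = +-cancelʳ-≡ 0 _ _ (subst₂ (λ a c → outdeg o′ v + a ≡ outdeg o v + c) (δ-other v≢i) (δ-other v≢j) (shift v))
    by-cases : Dec (v ≡ i) → Dec (v ≡ j) → P v
    by-cases (yes v≡i) _         = subst P (sym v≡i) at-i
    by-cases (no v≢i)  (yes v≡j) = subst P (sym v≡j) at-j
    by-cases (no v≢i)  (no v≢j)  = elsewhere v≢i v≢j

  potential-drop : ∀ {o′ o i j} → ScoreShift o′ o i j →
    0ℤ ℤ.< excess o i → excess o j ℤ.< 0ℤ → potential o′ < potential o
  potential-drop {o′} {o} {i} {j} shift surplus deficit =
    subst (potential o′ <_) total-drop (m<m+n (potential o′) (s≤s z≤n))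
    where
    total-drop : potential o′ + 2 ≡ potential o
    total-drop = begin
      potential o′ + 2
        ≡⟨ +-assoc (potential o′) 1 1 ⟨
      potential o′ + 1 + 1
        ≡⟨ cong₂ (λ a c → potential o′ + a + c) (sum-δ i) (sum-δ j) ⟨
      potential o′ + sumℕ (λ v → δ v i) + sumℕ (λ v → δ v j)
        ≡⟨ cong (_+ sumℕ (λ v → δ v j)) (sum-+ (λ v → ∣ excess o′ v ∣) (λ v → δ v i)) ⟨
      sumℕ (λ v → ∣ excess o′ v ∣ + δ v i) + sumℕ (λ v → δ v j)
        ≡⟨ sum-+ (λ v → ∣ excess o′ v ∣ + δ v i) (λ v → δ v j) ⟨
      sumℕ (λ v → ∣ excess o′ v ∣ + δ v i + δ v j)
        ≡⟨ sum-cong (excess-shift {o′} {o} {i} {j} shift surplus deficit) ⟩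
      potential o                                                ∎

  -- From a vertex of positive excess some vertex of negative excess is
  -- reachable: otherwise the reachable set R would be absorbing with
  -- Σ_R excess > 0 and Σ_{V∖R} excess ≥ 0, against total excess 0.
  -- Reversing a simple path to it lowers the potential.
  improve : ∀ o i → 0ℤ ℤ.< excess o i → ∃ λ o′ → potential o′ < potential o
  improve o i surplus = search (closure (dir o) (λ _ → true) i refl)
    where
    search : Closure (dir o) (λ _ → true) i → ∃ λ o′ → potential o′ < potential o
    search R with any? (λ v → (Closure.set R v Bool.≟ true) ×-dec (excess o v ℤₚ.<? 0ℤ))
    ... | yes (j , Rj , deficit) =
      let (ys , path) = walk→path (Closure.walk R j Rj)
          (zs , simple-path , simple) = loop-erase ys path
          (o′ , shift) = reverse-path zs o i j simple-path simple
      in o′ , potential-drop {o′} {o} {i} {j} shift surplus deficit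
    ... | no no-deficit =
      ⊥-elim (ℤₚ.<-irrefl (sym (excess-total o)) (ℤₚ.<-≤-trans surplus (ℤₚ.≤-trans i≤R R≤total)))
      where
      open Closure R
      R-nonneg : ∀ v → 0ℤ ℤ.≤ (if set v then excess o v else 0ℤ)
      R-nonneg v with set v in Rv
      ... | true  = ℤₚ.≮⇒≥ (λ deficit → no-deficit (v , Rv , deficit))
      ... | false = ℤₚ.≤-refl
      absorbing : Absorbing o i set
      absorbing = record
        { root   = origin
        ; walks  = λ v Rv → weaken (dir-adj o) (λ _ Ru → Ru) (walk v Rv)
        ; closed = λ u w Ru u→w → closed u w Ru u→w refl
        }
      outside : 0ℤ ℤ.≤ sumOverZ (not ∘ set) (excess o)
      outside = absorbing-complement _ o i set (n<1+n _) absorbing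
      i≤R : excess o i ℤ.≤ sumOverZ set (excess o)
      i≤R = subst (ℤ._≤ sumOverZ set (excess o)) (cong (λ c → if c then excess o i else 0ℤ) origin)
                  (sumℤ-nonneg-≥ _ R-nonneg i)
      R≤total : sumOverZ set (excess o) ℤ.≤ sumℤ (excess o)
      R≤total = subst (sumOverZ set (excess o) ℤ.≤_)
                      (sym (sumOverZ-split (λ _ → true) set (excess o) (λ _ _ → refl)))
                      (ℤₚ.i≤i+j _ _ ⦃ ℤ.nonNegative outside ⦄)

  realized-or-surplus : ∀ o → (∀ v → excess o v ≡ 0ℤ) ⊎ ∃ (λ i → 0ℤ ℤ.< excess o i)
  realized-or-surplus o with any? (λ i → 0ℤ ℤₚ.<? excess o i)
  ... | yes surplus = inj₂ surplus
  ... | no no-surplus = inj₁ λ v → ℤₚ.≤-antisym (nonpos v)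
          (subst (ℤ._≤ excess o v) (excess-total o) (sumℤ-nonpos-≤ (excess o) nonpos v))
    where
    nonpos : ∀ v → excess o v ℤ.≤ 0ℤ
    nonpos v = ℤₚ.≮⇒≥ (λ surplus → no-surplus (v , surplus))

  realize : ∀ k o → potential o < k → IsScoreVector G r
  realize (suc k) o bound with realized-or-surplus o
  ... | inj₁ balanced = o , λ v → sym (ℤₚ.i-j≡0⇒i≡j (ℤ.+ outdeg o v) (r v) (balanced v))
  ... | inj₂ (i , surplus) =
    let (o′ , drop) = improve o i surplus in realize k o′ (<-≤-trans drop (≤-pred bound))

ascending : ∀ {n} (G : Graph n) → Orientation G
ascending {n} G = record { dir = dir′ ; dir-adj = dir-adj′ ; dir-one = dir-one′ }
  where
  dir′ : Fin n → Fin n → Bool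
  dir′ a b = adj G a b ∧ (toℕ a <ᵇ toℕ b)
  dir-adj′ : ∀ a b → dir′ a b ≡ true → adj G a b ≡ true
  dir-adj′ a b e with adj G a b
  ... | true = refl
  dir-one′ : ∀ a b → adj G a b ≡ true → dir′ a b ≡ not (dir′ b a)
  dir-one′ a b ab rewrite Graph.sym G b a | ab =
    exactly-one (toℕ a <ᵇ toℕ b) (toℕ b <ᵇ toℕ a)
      (one-smaller (toℕ a) (toℕ b) (λ a≡b → irrefl-distinct (adj G) (irrefl G) ab (toℕ-injective a≡b)))
    where
    exactly-one : ∀ p q → ⟦ p ⟧ + ⟦ q ⟧ ≡ 1 → p ≡ not q
    exactly-one true  false _ = refl
    exactly-one false true  _ = refl

necessity : ∀ {n} (G : Graph n) (r : Fin n → ℤ) → IsScoreVector G r →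
  sumℤ r ≡ ℤ.+ numEdges G × CutCondition G r
necessity G r (o , r≡score) = total , cut
  where
  total : sumℤ r ≡ ℤ.+ numEdges G
  total = trans (sumℤ-cong r≡score) (trans (sumℤ-pos (outdeg o)) (cong ℤ.+_ (outdeg-total o)))
  cut : CutCondition G r
  cut I _ _ _ _ = subst (λ t → ℤ.+ 2 ℤ.* t ℤ.≤ ℤ.+ (cutEdges G I + sumOverℕ I (deg G))) (sym on-I)
    (subst (ℤ._≤ ℤ.+ (cutEdges G I + sumOverℕ I (deg G))) (ℤₚ.pos-* 2 (sumOver (lookup I) (outdeg o)))
      (ℤ.+≤+ (score-bound o (lookup I))))
    where
    on-I : sumOverℤ I r ≡ ℤ.+ sumOver (lookup I) (outdeg o)
    on-I = trans (sumℤ-cong pointwise) (sumℤ-pos (λ v → if lookup I v then outdeg o v else 0))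
      where
      pointwise : ∀ v → (if lookup I v then r v else 0ℤ) ≡ ℤ.+ (if lookup I v then outdeg o v else 0)
      pointwise v with lookup I v
      ... | true  = r≡score v
      ... | false = refl

corollary4p12 : (n : ℕ) (G : Graph n) → Connected G → (r : Fin n → ℤ) →
    IsScoreVector G r ⇔
      (sumℤ r ≡ ℤ.+ numEdges G ×
       (∀ (I : Subset n) → Nonempty I → (∃ λ x → x ∉ I) →
          InducedConnected G I → InducedConnected G (∁ I) →
          ℤ.+ 2 ℤ.* sumOverℤ I r ℤ.≤ ℤ.+ (cutEdges G I + sumOverℕ I (deg G))))
corollary4p12 n G connected r = mk⇔ (necessity G r)
  λ (total , cut-condition) →
    Sufficiency.realize G connected r total cut-condition _ (ascending G) (n<1+n _)
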